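{- Fix $n\in\mathbb{N}$ and put $s_0=\lfloor (4n+2)/11\rfloor$ and $t_0=\lfloor 10n/11\rfloor$. Then for all integers $s,t$ with $0\le s\le t\le n$ one has $\mathcal{M}(n,s_0,t_0)\le \mathcal{M}(n,s,t)$, i.e. $(s_0,t_0)$ minimizes $\mathcal{M}(n,s,t)$.
   Context: $[n]=\{1,\dots,n\}$. For integers $0\le s\le t\le n$, the coloring $R^sB^{t-s}R^{n-t}$ of $[n]$ colors $1,\dots,s$ and $t+1,\dots,n$ red and $s+1,\dots,t$ blue. $\mathcal{M}(n,s,t)$ denotes the number of ordered triples $(x,y,z)\in[n]^3$ with $z=x+y$ whose three entries all have the same color under this coloring ($(x,y,x+y)$ and $(y,x,x+y)$ count separately when $x\neq y$). -}

module Defs where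

open import Data.Nat using (ℕ; zero; suc; _+_; _≤ᵇ_; _<ᵇ_)
open import Data.Bool using (Bool; _∨_; _∧_; if_then_else_)
open import Data.Bool.Properties using () renaming (_≟_ to _≟ᵇ_)
open import Data.List using (List; map)
open import Data.Nat.ListAction using (sum)
open import Relation.Nullary.Decidable using (⌊_⌋)

range : ℕ → List ℕ
range zero = Data.List.[]
range (suc n) = range n Data.List.++ Data.List.[ suc n ]

-- colour of i under R^s B^(t-s) R^(n-t): true = red, false = blue
-- i is red iff i ≤ s or t < i (for i ∈ [n])
isRed : ℕ → ℕ → ℕ → Bool
isRed s t i = (i ≤ᵇ s) ∨ (t <ᵇ i)

monoInd : ℕ → ℕ → ℕ → ℕ → ℕ → ℕ
monoInd n s t x y =
  if ((x + y) ≤ᵇ n) ∧ ⌊ isRed s t x ≟ᵇ isRed s t y ⌋ ∧ ⌊ isRed s t y ≟ᵇ isRed s t (x + y) ⌋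
  then 1 else 0

M : ℕ → ℕ → ℕ → ℕ
M n s t = sum (map (λ x → sum (map (λ y → monoInd n s t x y) (range n))) (range n))

module Submission where

-- Write a colouring as R^a B^b R^c (a = s, b = t - s, c = n - t).  Sorting the monochromatic
-- triples by their sum gives a closed form for M (`M-closed`) in terms of triangular numbers and
-- two sums `lowLow`, `lowHigh`, which are estimated explicitly.  Over ℤ this yields a dichotomy:
-- either 2M is at least the quadratic model Λ(a, b - a, c) = a(a-1) + (b-a)(b-a-1) + 2c(c-1),
-- or 11 · 2M ≥ Θ(n) = 2n² - 8n + 12, the latter proved region by region by sum-of-squares
-- certificates.  Hence any F that lies below Λ on the plane a + b + c = n and satisfies
-- 11 F ≤ Θ(n) is a lower bound for 2M (`lower-bound`).  For n = r + 11k the candidate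
-- (a, b - a, c) = (α + 4k, β + 2k, γ + k) minimises Λ on integer points (its increment is a
-- non-negative combination of products of consecutive integers), its Λ-value is 2M(n, s₀, t₀)
-- (`M-short-top`), and Θ(n) - 11 Λ is a constant depending on r only.  The data of the eleven
-- residues are checked by evaluation (`optimum-table`); n ≤ 4 is checked directly.

open import Defs

module Sums where

  open import Data.Nat using (ℕ; zero; suc; _+_; _*_; _≤_; z≤n; s≤s)
  open import Data.Nat.Properties
    using (+-assoc; +-comm; +-suc; +-identityʳ; ≤-refl; m≤n⇒m≤1+n)
  open import Data.List using ([]; _∷_; _++_; map)
  open import Data.List.Properties using (map-++)
  open import Data.Nat.ListAction using (sum)
  open import Data.Nat.ListAction.Properties using (sum-++)
  open import Relation.Binary.PropositionalEquality
  open ≡-Reasoning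

  sumTo : (ℕ → ℕ) → ℕ → ℕ
  sumTo f zero    = 0
  sumTo f (suc n) = sumTo f n + f (suc n)

  sum-range : ∀ f n → sum (map f (range n)) ≡ sumTo f n
  sum-range f zero    = refl
  sum-range f (suc n) = begin
    sum (map f (range n ++ suc n ∷ []))       ≡⟨ cong sum (map-++ f (range n) (suc n ∷ [])) ⟩
    sum (map f (range n) ++ f (suc n) ∷ [])   ≡⟨ sum-++ (map f (range n)) (f (suc n) ∷ []) ⟩
    sum (map f (range n)) + (f (suc n) + 0)   ≡⟨ cong₂ _+_ (sum-range f n) (+-identityʳ _) ⟩
    sumTo f n + f (suc n)                     ∎

  sumTo-cong : ∀ {f g} n → (∀ i → 1 ≤ i → i ≤ n → f i ≡ g i) → sumTo f n ≡ sumTo g n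
  sumTo-cong zero    h = refl
  sumTo-cong (suc n) h =
    cong₂ _+_ (sumTo-cong n λ i p q → h i p (m≤n⇒m≤1+n q)) (h (suc n) (s≤s z≤n) ≤-refl)

  sumTo-+ : ∀ f g n → sumTo (λ i → f i + g i) n ≡ sumTo f n + sumTo g n
  sumTo-+ f g zero    = refl
  sumTo-+ f g (suc n) = begin
    sumTo (λ i → f i + g i) n + (f (suc n) + g (suc n))
      ≡⟨ cong (_+ (f (suc n) + g (suc n))) (sumTo-+ f g n) ⟩
    (F + G) + (f (suc n) + g (suc n))     ≡⟨ +-assoc F G _ ⟩
    F + (G + (f (suc n) + g (suc n)))     ≡⟨ cong (F +_) (+-comm G _) ⟩
    F + ((f (suc n) + g (suc n)) + G)     ≡⟨ cong (F +_) (+-assoc (f (suc n)) (g (suc n)) G) ⟩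
    F + (f (suc n) + (g (suc n) + G))     ≡⟨ sym (+-assoc F (f (suc n)) _) ⟩
    (F + f (suc n)) + (g (suc n) + G)     ≡⟨ cong ((F + f (suc n)) +_) (+-comm (g (suc n)) G) ⟩
    (F + f (suc n)) + (G + g (suc n))     ∎
    where
    F = sumTo f n
    G = sumTo g n

  sumTo-split : ∀ f m k → sumTo f (m + k) ≡ sumTo f m + sumTo (λ i → f (m + i)) k
  sumTo-split f m zero    = trans (cong (sumTo f) (+-identityʳ m)) (sym (+-identityʳ _))
  sumTo-split f m (suc k) = begin
    sumTo f (m + suc k)                                       ≡⟨ cong (sumTo f) (+-suc m k) ⟩
    sumTo f (m + k) + f (suc (m + k))                         ≡⟨ cong (_+ f (suc (m + k))) (sumTo-split f m k) ⟩
    sumTo f m + sumTo (λ i → f (m + i)) k + f (suc (m + k))   ≡⟨ +-assoc (sumTo f m) _ _ ⟩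
    sumTo f m + (sumTo (λ i → f (m + i)) k + f (suc (m + k)))
      ≡⟨ cong (λ j → sumTo f m + (sumTo (λ i → f (m + i)) k + f j)) (sym (+-suc m k)) ⟩
    sumTo f m + sumTo (λ i → f (m + i)) (suc k)               ∎

  sumTo-const : ∀ c n → sumTo (λ _ → c) n ≡ n * c
  sumTo-const c zero    = refl
  sumTo-const c (suc n) = trans (cong (_+ c) (sumTo-const c n)) (+-comm (n * c) c)


-- M as a sum, over z, of the number of monochromatic pairs with sum z.
module Counting where

  open import Data.Nat using (ℕ; zero; suc; pred; _+_; _*_; _∸_; _≤_; _<_; _≤ᵇ_)
  open import Data.Nat.Properties
  open import Data.Bool using (Bool; true; false; _∧_; if_then_else_; T)
  open import Data.Bool.Properties using () renaming (_≟_ to _≟ᵇ_)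
  open import Relation.Nullary.Decidable using (⌊_⌋)
  open import Data.Unit using (tt)
  open import Data.Empty using (⊥-elim)
  open import Relation.Binary.PropositionalEquality
  open ≡-Reasoning

  open Sums

  𝟙 : Bool → ℕ
  𝟙 b = if b then 1 else 0

  mono : ℕ → ℕ → ℕ → ℕ → Bool
  mono s t x y = ⌊ isRed s t x ≟ᵇ isRed s t y ⌋ ∧ ⌊ isRed s t y ≟ᵇ isRed s t (x + y) ⌋

  classCount : ℕ → ℕ → ℕ → ℕ
  classCount s t m = sumTo (λ x → 𝟙 (mono s t x (suc m ∸ x))) m

  ≤ᵇ-true : ∀ {m n} → m ≤ n → (m ≤ᵇ n) ≡ true
  ≤ᵇ-true {m} {n} p with m ≤ᵇ n | ≤⇒≤ᵇ p
  ... | true | _ = refl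

  ≤ᵇ-false : ∀ {m n} → n < m → (m ≤ᵇ n) ≡ false
  ≤ᵇ-false {m} {n} p with m ≤ᵇ n in eq
  ... | false = refl
  ... | true  = ⊥-elim (<⇒≱ p (≤ᵇ⇒≤ m n (subst T (sym eq) tt)))

  row-cut : ∀ n s t x → 1 ≤ x → x ≤ n →
    sumTo (λ y → monoInd n s t x y) n ≡ sumTo (λ y → 𝟙 (mono s t x y)) (n ∸ x)
  row-cut n s t x 1≤x x≤n =
    subst (λ N → sumTo (λ y → monoInd N s t x y) N ≡ sumTo (λ y → 𝟙 (mono s t x y)) (n ∸ x))
          (m∸n+n≡m x≤n) (cut (n ∸ x))
    where
    cut : ∀ k → sumTo (λ y → monoInd (k + x) s t x y) (k + x) ≡ sumTo (λ y → 𝟙 (mono s t x y)) k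
    cut k = begin
      sumTo (λ y → monoInd (k + x) s t x y) (k + x)
        ≡⟨ sumTo-split _ k x ⟩
      sumTo (λ y → monoInd (k + x) s t x y) k + sumTo (λ i → monoInd (k + x) s t x (k + i)) x
        ≡⟨ cong₂ _+_ (sumTo-cong k inside) (trans (sumTo-cong x outside) (sumTo-const 0 x)) ⟩
      sumTo (λ y → 𝟙 (mono s t x y)) k + x * 0
        ≡⟨ cong (sumTo (λ y → 𝟙 (mono s t x y)) k +_) (*-zeroʳ x) ⟩
      sumTo (λ y → 𝟙 (mono s t x y)) k + 0
        ≡⟨ +-identityʳ _ ⟩
      sumTo (λ y → 𝟙 (mono s t x y)) k ∎
      where
      inside : ∀ y → 1 ≤ y → y ≤ k → monoInd (k + x) s t x y ≡ 𝟙 (mono s t x y)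
      inside y _ y≤k rewrite ≤ᵇ-true (subst (x + y ≤_) (+-comm x k) (+-monoʳ-≤ x y≤k)) = refl
      too-big : ∀ i → 1 ≤ i → k + x < x + (k + i)
      too-big i 1≤i = subst (k + x <_) (trans (cong (_+ i) (+-comm k x)) (+-assoc x k i)) (m<m+n (k + x) 1≤i)
      outside : ∀ i → 1 ≤ i → i ≤ x → monoInd (k + x) s t x (k + i) ≡ 0
      outside i 1≤i _ rewrite ≤ᵇ-false {x + (k + i)} {k + x} (too-big i 1≤i) = refl

  triangleCount : ℕ → ℕ → ℕ → ℕ
  triangleCount n s t = sumTo (λ x → sumTo (λ y → 𝟙 (mono s t x y)) (n ∸ x)) n

  triangleCount-suc : ∀ n s t → triangleCount (suc n) s t ≡ triangleCount n s t + classCount s t n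
  triangleCount-suc n s t = begin
    sumTo row' n + sumTo (λ y → 𝟙 (mono s t (suc n) y)) (n ∸ n)
      ≡⟨ cong (λ k → sumTo row' n + sumTo (λ y → 𝟙 (mono s t (suc n) y)) k) (n∸n≡0 n) ⟩
    sumTo row' n + 0
      ≡⟨ +-identityʳ _ ⟩
    sumTo row' n
      ≡⟨ sumTo-cong n (λ x _ x≤n → cong (sumTo (λ y → 𝟙 (mono s t x y))) (+-∸-assoc 1 x≤n)) ⟩
    sumTo (λ x → row x + 𝟙 (mono s t x (suc (n ∸ x)))) n
      ≡⟨ sumTo-+ row _ n ⟩
    triangleCount n s t + sumTo (λ x → 𝟙 (mono s t x (suc (n ∸ x)))) n
      ≡⟨ cong (triangleCount n s t +_)
           (sumTo-cong n (λ x _ x≤n → cong (λ y → 𝟙 (mono s t x y)) (sym (+-∸-assoc 1 x≤n)))) ⟩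
    triangleCount n s t + classCount s t n ∎
    where
    row row' : ℕ → ℕ
    row  x = sumTo (λ y → 𝟙 (mono s t x y)) (n ∸ x)
    row' x = sumTo (λ y → 𝟙 (mono s t x y)) (suc n ∸ x)

  M-by-sum : ∀ n s t → M n s t ≡ sumTo (λ z → classCount s t (pred z)) n
  M-by-sum n s t = begin
    M n s t
      ≡⟨ trans (sum-range _ n) (sumTo-cong n (λ x _ _ → sum-range _ n)) ⟩
    sumTo (λ x → sumTo (λ y → monoInd n s t x y) n) n
      ≡⟨ sumTo-cong n (row-cut n s t) ⟩
    triangleCount n s t
      ≡⟨ by-sum n ⟩
    sumTo (λ z → classCount s t (pred z)) n ∎
    where
    by-sum : ∀ n → triangleCount n s t ≡ sumTo (λ z → classCount s t (pred z)) n
    by-sum zero    = refl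
    by-sum (suc n) = trans (triangleCount-suc n s t) (cong (_+ classCount s t n) (by-sum n))


-- The number of monochromatic pairs with sum z, for z in each of the three blocks.
module Blocks where

  open import Data.Nat using (ℕ; zero; suc; _+_; _*_; _∸_; _≤_; _<_; _⊓_; _⊔_; _≤ᵇ_; _<ᵇ_; s≤s)
  open import Data.Nat.Properties
  open import Data.Bool using (Bool; true; false; _∧_; _∨_; not; T)
  open import Data.Bool.Properties using (∧-comm; ∧-zeroʳ; ∧-identityʳ; ∨-zeroʳ) renaming (_≟_ to _≟ᵇ_)
  open import Relation.Nullary using (yes; no)
  open import Relation.Nullary.Decidable using (⌊_⌋)
  open import Data.Unit using (tt)
  open import Relation.Binary.PropositionalEquality
  open import Data.Nat.Tactic.RingSolver using (solve-∀)

  open Sums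
  open Counting

  sameColour : Bool → Bool → Bool → ℕ
  sameColour a b c = 𝟙 (⌊ a ≟ᵇ b ⌋ ∧ ⌊ b ≟ᵇ c ⌋)

  mono-at : ∀ s t x y z → x + y ≡ z →
    𝟙 (mono s t x y) ≡ sameColour (isRed s t x) (isRed s t y) (isRed s t z)
  mono-at s t x y .(x + y) refl = refl

  -- If the sum is red, (x , y) is counted once for each way of making both summands red,
  -- a summand being red either by lying in the low block (P) or in the high block (Q).
  sameColour-red : ∀ P Q P′ Q′ → (P ∧ Q) ≡ false → (P′ ∧ Q′) ≡ false →
    sameColour (P ∨ Q) (P′ ∨ Q′) true ≡ 𝟙 (P ∧ P′) + 𝟙 (P ∧ Q′) + 𝟙 (Q ∧ P′) + 𝟙 (Q ∧ Q′)
  sameColour-red true  true  _     _     () _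
  sameColour-red _     _     true  true  _  ()
  sameColour-red true  false true  false _  _ = refl
  sameColour-red true  false false true  _  _ = refl
  sameColour-red true  false false false _  _ = refl
  sameColour-red false true  true  false _  _ = refl
  sameColour-red false true  false true  _  _ = refl
  sameColour-red false true  false false _  _ = refl
  sameColour-red false false true  false _  _ = refl
  sameColour-red false false false true  _  _ = refl
  sameColour-red false false false false _  _ = refl

  sameColour-blue : ∀ P P′ → sameColour (P ∨ false) (P′ ∨ false) false ≡ 𝟙 (not P ∧ not P′)
  sameColour-blue true  true  = refl
  sameColour-blue true  false = refl
  sameColour-blue false true  = refl
  sameColour-blue false false = refl

  ≤ᵇ-suc : ∀ a b → (suc a ≤ᵇ suc b) ≡ (a ≤ᵇ b)
  ≤ᵇ-suc zero    b = refl
  ≤ᵇ-suc (suc a) b = refl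

  ∸-≤ᵇ : ∀ m x s → (m ∸ x ≤ᵇ s) ≡ (m ≤ᵇ x + s)
  ∸-≤ᵇ m       zero    s = refl
  ∸-≤ᵇ zero    (suc x) s = refl
  ∸-≤ᵇ (suc m) (suc x) s = trans (∸-≤ᵇ m x s) (sym (≤ᵇ-suc m (x + s)))

  <ᵇ-∸ : ∀ a m x → (suc a ≤ᵇ m ∸ x) ≡ (suc a + x ≤ᵇ m)
  <ᵇ-∸ a m       zero    = cong (_≤ᵇ m) (sym (+-identityʳ (suc a)))
  <ᵇ-∸ a zero    (suc x) = refl
  <ᵇ-∸ a (suc m) (suc x) =
    trans (<ᵇ-∸ a m x) (trans (sym (≤ᵇ-suc (suc a + x) m)) (cong (_≤ᵇ suc m) (sym (+-suc (suc a) x))))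

  ⊓-≤ᵇ : ∀ x a b → ((x ≤ᵇ a) ∧ (x ≤ᵇ b)) ≡ (x ≤ᵇ a ⊓ b)
  ⊓-≤ᵇ zero    a       b       = refl
  ⊓-≤ᵇ (suc x) zero    b       = refl
  ⊓-≤ᵇ (suc x) (suc a) zero    = ∧-zeroʳ _
  ⊓-≤ᵇ (suc x) (suc a) (suc b)
    rewrite ≤ᵇ-suc x a | ≤ᵇ-suc x b | ≤ᵇ-suc x (a ⊓ b) = ⊓-≤ᵇ x a b

  ⊔-<ᵇ : ∀ x a b → ((a <ᵇ x) ∧ (b <ᵇ x)) ≡ (a ⊔ b <ᵇ x)
  ⊔-<ᵇ zero    a       b       = refl
  ⊔-<ᵇ (suc x) zero    b       = refl
  ⊔-<ᵇ (suc x) (suc a) zero    = ∧-identityʳ _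
  ⊔-<ᵇ (suc x) (suc a) (suc b) = ⊔-<ᵇ x a b

  not-≤ᵇ : ∀ x s → not (x ≤ᵇ s) ≡ (s <ᵇ x)
  not-≤ᵇ zero    zero    = refl
  not-≤ᵇ zero    (suc s) = refl
  not-≤ᵇ (suc x) zero    = refl
  not-≤ᵇ (suc x) (suc s) rewrite ≤ᵇ-suc x s = not-≤ᵇ x s

  -- For the pair (suc x , m ∸ x) summing to suc m, conditions on the second summand
  -- are conditions on the first one.
  partner-low : ∀ m s x → (m ∸ x ≤ᵇ s) ≡ (m ∸ s <ᵇ suc x)
  partner-low m s x =
    trans (∸-≤ᵇ m x s) (trans (cong (m ≤ᵇ_) (+-comm x s)) (trans (sym (∸-≤ᵇ m s x)) (sym (≤ᵇ-suc (m ∸ s) x))))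

  partner-high : ∀ m t x → (t <ᵇ m ∸ x) ≡ (suc x ≤ᵇ m ∸ t)
  partner-high m t x = trans (<ᵇ-∸ t m x) (trans (cong (λ w → suc w ≤ᵇ m) (+-comm t x)) (sym (<ᵇ-∸ x m t)))

  blocks-disjoint : ∀ x s t → s ≤ t → ((x ≤ᵇ s) ∧ (t <ᵇ x)) ≡ false
  blocks-disjoint x s t s≤t with x ≤ᵇ s in eq
  ... | false = refl
  ... | true  = ≤ᵇ-false {suc t} {x} (s≤s (≤-trans (≤ᵇ⇒≤ x s (subst T (sym eq) tt)) s≤t))

  between : ℕ → ℕ → ℕ → Bool
  between lo hi x = (lo <ᵇ x) ∧ (x ≤ᵇ hi)

  count-between : ∀ lo hi m → sumTo (λ x → 𝟙 (between lo hi x)) m ≡ hi ⊓ m ∸ lo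
  count-between lo hi zero rewrite ⊓-zeroʳ hi = sym (0∸n≡0 lo)
  count-between lo hi (suc m) with suc m ≤? hi
  ... | yes m<hi
    rewrite count-between lo hi m | ≤ᵇ-true m<hi | ∧-identityʳ (lo <ᵇ suc m)
          | m≥n⇒m⊓n≡n m<hi | m≥n⇒m⊓n≡n (≤-trans (n≤1+n m) m<hi) = step lo m
    where
    step : ∀ lo m → m ∸ lo + 𝟙 (lo <ᵇ suc m) ≡ suc m ∸ lo
    step zero    m    = +-comm m 1
    step (suc lo) zero rewrite 0∸n≡0 lo = refl
    step (suc lo) (suc m) = step lo m
  ... | no m≮hi
    rewrite count-between lo hi m | ≤ᵇ-false {suc m} {hi} (≰⇒> m≮hi) | ∧-zeroʳ (lo <ᵇ suc m)
          | m≤n⇒m⊓n≡m (≮⇒≥ m≮hi) | m≤n⇒m⊓n≡m (≤-trans (≮⇒≥ m≮hi) (n≤1+n m)) = +-identityʳ _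

  -- For a red sum, the four terms are the pairs low/low (x ∈ (m - s , s]),
  -- low/high (x ∈ (0 , s ⊓ (m - t)]), high/low (x ∈ (t ⊔ (m - s) , m]) and high/high
  -- (x ∈ (t , m - t]).
  pair-low : ∀ s t m x → m < s → x < m → 𝟙 (mono s t (suc x) (m ∸ x)) ≡ 1
  pair-low s t m x m<s x<m
    rewrite mono-at s t (suc x) (m ∸ x) (suc m) (cong suc (m+[n∸m]≡n (<⇒≤ x<m)))
          | ≤ᵇ-true (≤-trans x<m (<⇒≤ m<s)) | ≤ᵇ-true (≤-trans (m∸n≤m m x) (<⇒≤ m<s))
          | ≤ᵇ-true m<s = refl

  pair-blue : ∀ s t m x → s ≤ m → m < t → x < m →
    𝟙 (mono s t (suc x) (m ∸ x)) ≡ 𝟙 (between s (m ∸ s) (suc x))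
  pair-blue s t m x s≤m m<t x<m
    rewrite mono-at s t (suc x) (m ∸ x) (suc m) (cong suc (m+[n∸m]≡n (<⇒≤ x<m)))
          | ≤ᵇ-false {suc t} {suc x} (s≤s (<-≤-trans x<m (<⇒≤ m<t)))
          | ≤ᵇ-false {suc t} {m ∸ x} (s≤s (≤-trans (m∸n≤m m x) (<⇒≤ m<t)))
          | ≤ᵇ-false {suc m} {s} (s≤s s≤m) | ≤ᵇ-false {suc t} {suc m} (s≤s m<t)
          | sameColour-blue (suc x ≤ᵇ s) (m ∸ x ≤ᵇ s)
          | not-≤ᵇ (suc x) s | not-≤ᵇ (m ∸ x) s | partner-high m s x = refl

  pair-red : ∀ s t m x → s ≤ t → t ≤ m → x < m →
    𝟙 (mono s t (suc x) (m ∸ x)) ≡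
      𝟙 (between (m ∸ s) s (suc x)) + 𝟙 (between 0 (s ⊓ (m ∸ t)) (suc x))
      + 𝟙 (between (t ⊔ (m ∸ s)) m (suc x)) + 𝟙 (between t (m ∸ t) (suc x))
  pair-red s t m x s≤t t≤m x<m
    rewrite mono-at s t (suc x) (m ∸ x) (suc m) (cong suc (m+[n∸m]≡n (<⇒≤ x<m)))
          | ≤ᵇ-true {suc t} {suc m} (s≤s t≤m) | ∨-zeroʳ (suc m ≤ᵇ s)
          | sameColour-red (suc x ≤ᵇ s) (t <ᵇ suc x) (m ∸ x ≤ᵇ s) (t <ᵇ m ∸ x)
                           (blocks-disjoint (suc x) s t s≤t) (blocks-disjoint (m ∸ x) s t s≤t)
          | partner-low m s x | partner-high m t x
          | ∧-comm (suc x ≤ᵇ s) (m ∸ s <ᵇ suc x) | ⊓-≤ᵇ (suc x) s (m ∸ t)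
          | ⊔-<ᵇ (suc x) t (m ∸ s) | ≤ᵇ-true x<m | ∧-identityʳ (t ⊔ (m ∸ s) <ᵇ suc x) = refl

  -- Counting the pairs summing to suc m; the low/high and high/low pairs are equinumerous.
  classCount-low : ∀ s t m → m < s → classCount s t m ≡ m
  classCount-low s t m m<s =
    trans (sumTo-cong m (λ { (suc x) _ x<m → pair-low s t m x m<s x<m }))
          (trans (sumTo-const 1 m) (*-identityʳ m))

  classCount-blue : ∀ s t m → s ≤ m → m < t → classCount s t m ≡ m ∸ s ∸ s
  classCount-blue s t m s≤m m<t =
    trans (sumTo-cong m (λ { (suc x) _ x<m → pair-blue s t m x s≤m m<t x<m }))
          (trans (count-between s (m ∸ s) m) (cong (_∸ s) (m≤n⇒m⊓n≡m (m∸n≤m m s))))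

  classCount-red : ∀ s t m → s ≤ t → t ≤ m →
    classCount s t m ≡ (s ∸ (m ∸ s)) + 2 * (s ⊓ (m ∸ t)) + (m ∸ t ∸ t)
  classCount-red s t m s≤t t≤m = begin
    classCount s t m
      ≡⟨ sumTo-cong m (λ { (suc x) _ x<m → pair-red s t m x s≤t t≤m x<m }) ⟩
    sumTo (λ x → LL x + LH x + HL x + HH x) m
      ≡⟨ sumTo-+ _ HH m ⟩
    sumTo (λ x → LL x + LH x + HL x) m + sumTo HH m
      ≡⟨ cong (_+ sumTo HH m) (sumTo-+ _ HL m) ⟩
    sumTo (λ x → LL x + LH x) m + sumTo HL m + sumTo HH m
      ≡⟨ cong (λ w → w + sumTo HL m + sumTo HH m) (sumTo-+ LL LH m) ⟩
    sumTo LL m + sumTo LH m + sumTo HL m + sumTo HH m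
      ≡⟨ cong₂ _+_ (cong₂ _+_ (cong₂ _+_ (count-between (m ∸ s) s m) (count-between 0 (s ⊓ (m ∸ t)) m))
                              (count-between (t ⊔ (m ∸ s)) m m))
                   (count-between t (m ∸ t) m) ⟩
    s ⊓ m ∸ (m ∸ s) + (s ⊓ (m ∸ t) ⊓ m ∸ 0) + (m ⊓ m ∸ (t ⊔ (m ∸ s))) + ((m ∸ t) ⊓ m ∸ t)
      ≡⟨ cong₂ _+_ (cong₂ _+_ (cong₂ _+_ low-low low-high) high-low) high-high ⟩
    (s ∸ (m ∸ s)) + s ⊓ (m ∸ t) + s ⊓ (m ∸ t) + (m ∸ t ∸ t)
      ≡⟨ collect (s ∸ (m ∸ s)) (s ⊓ (m ∸ t)) (m ∸ t ∸ t) ⟩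
    (s ∸ (m ∸ s)) + 2 * (s ⊓ (m ∸ t)) + (m ∸ t ∸ t) ∎
    where
    open ≡-Reasoning
    s≤m = ≤-trans s≤t t≤m
    LL LH HL HH : ℕ → ℕ
    LL x = 𝟙 (between (m ∸ s) s x)
    LH x = 𝟙 (between 0 (s ⊓ (m ∸ t)) x)
    HL x = 𝟙 (between (t ⊔ (m ∸ s)) m x)
    HH x = 𝟙 (between t (m ∸ t) x)
    low-low : s ⊓ m ∸ (m ∸ s) ≡ s ∸ (m ∸ s)
    low-low = cong (_∸ (m ∸ s)) (m≤n⇒m⊓n≡m s≤m)
    low-high : s ⊓ (m ∸ t) ⊓ m ∸ 0 ≡ s ⊓ (m ∸ t)
    low-high = m≤n⇒m⊓n≡m (≤-trans (m⊓n≤n s (m ∸ t)) (m∸n≤m m t))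
    high-low : m ⊓ m ∸ (t ⊔ (m ∸ s)) ≡ s ⊓ (m ∸ t)
    high-low = begin
      m ⊓ m ∸ (t ⊔ (m ∸ s))        ≡⟨ cong (_∸ (t ⊔ (m ∸ s))) (⊓-idem m) ⟩
      m ∸ (t ⊔ (m ∸ s))            ≡⟨ ∸-distribˡ-⊔-⊓ m t (m ∸ s) ⟩
      (m ∸ t) ⊓ (m ∸ (m ∸ s))      ≡⟨ cong ((m ∸ t) ⊓_) (m∸[m∸n]≡n s≤m) ⟩
      (m ∸ t) ⊓ s                  ≡⟨ ⊓-comm (m ∸ t) s ⟩
      s ⊓ (m ∸ t)                  ∎
    high-high : (m ∸ t) ⊓ m ∸ t ≡ m ∸ t ∸ t
    high-high = cong (_∸ t) (m≤n⇒m⊓n≡m (m∸n≤m m t))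
    collect : ∀ a b c → a + b + b + c ≡ a + 2 * b + c
    collect = solve-∀


module ClosedForm where

  open import Data.Nat using (ℕ; zero; suc; pred; _+_; _*_; _∸_; _⊓_)
  open import Data.Nat.Properties
  open import Relation.Nullary using (yes; no)
  open import Relation.Binary.PropositionalEquality
  open ≡-Reasoning
  open import Data.Nat.Tactic.RingSolver using (solve-∀)

  open Sums
  open Counting
  open Blocks

  tri : ℕ → ℕ
  tri zero    = 0
  tri (suc n) = tri n + n

  sumTo-pred∸ : ∀ k b → sumTo (λ j → pred j ∸ k) b ≡ tri (b ∸ k)
  sumTo-pred∸ k zero = cong tri (sym (0∸n≡0 k))
  sumTo-pred∸ k (suc b) rewrite sumTo-pred∸ k b with k ≤? b
  ... | yes k≤b rewrite +-∸-assoc 1 k≤b = refl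
  ... | no  k≰b rewrite m≤n⇒m∸n≡0 (≰⇒≥ k≰b) | m≤n⇒m∸n≡0 (≰⇒> k≰b) = refl

  -- For a red sum z = s + b + j in the top block:
  -- the pairs with both summands in the low block [1, s] …
  lowLow : ℕ → ℕ → ℕ → ℕ
  lowLow s b c = sumTo (λ j → s ∸ (b + pred j)) c

  -- … and, up to the factor 2 for the order, those with one summand low and one high.
  lowHigh : ℕ → ℕ → ℕ
  lowHigh s c = sumTo (λ j → s ⊓ pred j) c

  private
    sumTo-shift : ∀ f m k → sumTo (λ j → f (m + j)) k ≡ sumTo (λ j → f (suc (m + pred j))) k
    sumTo-shift f m k = sumTo-cong k (λ { (suc j) _ _ → cong f (+-suc m j) })

  -- The five terms count monochromatic triples whose sum is low,
  -- blue, red with two low summands, red with a low and a high summand, red with two high ones.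
  M-closed : ∀ s b c →
    M (s + b + c) s (s + b) ≡ tri s + tri (b ∸ s) + lowLow s b c + 2 * lowHigh s c + tri (c ∸ (s + b))
  M-closed s b c = begin
    M (s + b + c) s t
      ≡⟨ M-by-sum (s + b + c) s t ⟩
    sumTo D (s + b + c)
      ≡⟨ sumTo-split D t c ⟩
    sumTo D t + sumTo (λ j → D (t + j)) c
      ≡⟨ cong (_+ sumTo (λ j → D (t + j)) c) (sumTo-split D s b) ⟩
    sumTo D s + sumTo (λ j → D (s + j)) b + sumTo (λ j → D (t + j)) c
      ≡⟨ cong₂ _+_ (cong₂ _+_ low-block blue-block) red-block ⟩
    tri s + tri (b ∸ s) + (lowLow s b c + 2 * lowHigh s c + tri (c ∸ t))
      ≡⟨ reassociate (tri s) (tri (b ∸ s)) (lowLow s b c) (lowHigh s c) (tri (c ∸ t)) ⟩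
    tri s + tri (b ∸ s) + lowLow s b c + 2 * lowHigh s c + tri (c ∸ t) ∎
    where
    t = s + b
    D : ℕ → ℕ
    D z = classCount s t (pred z)
    reassociate : ∀ x y z u v → x + y + (z + 2 * u + v) ≡ x + y + z + 2 * u + v
    reassociate = solve-∀
    low-block : sumTo D s ≡ tri s
    low-block = trans (sumTo-cong s (λ { (suc m) _ m<s → classCount-low s t m m<s })) (sumTo-pred∸ 0 s)
    blue-block : sumTo (λ j → D (s + j)) b ≡ tri (b ∸ s)
    blue-block = begin
      sumTo (λ j → D (s + j)) b
        ≡⟨ sumTo-shift D s b ⟩
      sumTo (λ j → classCount s t (s + pred j)) b
        ≡⟨ sumTo-cong b (λ { (suc j) _ j<b →
             trans (classCount-blue s t (s + j) (m≤m+n s j) (+-monoʳ-< s j<b))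
                   (cong (_∸ s) (m+n∸m≡n s j)) }) ⟩
      sumTo (λ j → pred j ∸ s) b
        ≡⟨ sumTo-pred∸ s b ⟩
      tri (b ∸ s) ∎
    red-block : sumTo (λ j → D (t + j)) c ≡ lowLow s b c + 2 * lowHigh s c + tri (c ∸ t)
    red-block = begin
      sumTo (λ j → D (t + j)) c
        ≡⟨ sumTo-shift D t c ⟩
      sumTo (λ j → classCount s t (t + pred j)) c
        ≡⟨ sumTo-cong c (λ { (suc i) _ _ →
             trans (classCount-red s t (t + i) (m≤m+n s b) (m≤m+n t i))
                   (cong₂ _+_ (cong₂ _+_ (cong (s ∸_) (trans (cong (_∸ s) (+-assoc s b i)) (m+n∸m≡n s (b + i))))
                                         (cong (λ w → 2 * (s ⊓ w)) (m+n∸m≡n t i)))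
                              (cong (_∸ t) (m+n∸m≡n t i))) }) ⟩
      sumTo (λ j → (s ∸ (b + pred j)) + 2 * (s ⊓ pred j) + (pred j ∸ t)) c
        ≡⟨ sumTo-+ _ (λ j → pred j ∸ t) c ⟩
      sumTo (λ j → (s ∸ (b + pred j)) + 2 * (s ⊓ pred j)) c + sumTo (λ j → pred j ∸ t) c
        ≡⟨ cong₂ _+_ (trans (sumTo-+ _ _ c) (cong (lowLow s b c +_) (double c))) (sumTo-pred∸ t c) ⟩
      lowLow s b c + 2 * lowHigh s c + tri (c ∸ t) ∎
      where
      double : ∀ c → sumTo (λ j → 2 * (s ⊓ pred j)) c ≡ 2 * lowHigh s c
      double zero    = refl
      double (suc c) = trans (cong (_+ 2 * (s ⊓ c)) (double c)) (sym (*-distribˡ-+ 2 (lowHigh s c) (s ⊓ c)))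


module Estimates where

  open import Data.Nat using (zero; suc; pred; _+_; _*_; _∸_; _≤_; _⊓_; s≤s; s≤s⁻¹)
  open import Data.Nat.Properties
  open import Relation.Binary.PropositionalEquality
  open import Data.Nat.Tactic.RingSolver using (solve-∀)

  open Sums
  open ClosedForm

  tri-square : ∀ x → 2 * tri x + x ≡ x * x
  tri-square zero    = refl
  tri-square (suc x) = begin
    2 * (tri x + x) + suc x       ≡⟨ expand (tri x) x ⟩
    (2 * tri x + x) + 2 * x + 1   ≡⟨ cong (λ w → w + 2 * x + 1) (tri-square x) ⟩
    x * x + 2 * x + 1             ≡⟨ square x ⟩
    suc x * suc x                 ∎
    where
    open ≡-Reasoning
    expand : ∀ y x → 2 * (y + x) + suc x ≡ (2 * y + x) + 2 * x + 1
    expand = solve-∀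
    square : ∀ x → x * x + 2 * x + 1 ≡ suc x * suc x
    square = solve-∀

  tri-small : ∀ x → x ≤ 1 → tri x ≡ 0
  tri-small zero          _ = refl
  tri-small (suc zero)    _ = refl
  tri-small (suc (suc x)) (s≤s ())

  descending : ∀ d → sumTo (λ j → d ∸ pred j) d ≡ tri (suc d)
  descending zero    = refl
  descending (suc d) = begin
    sumTo (λ j → suc d ∸ pred j) d + (suc d ∸ d)
      ≡⟨ cong₂ _+_ (sumTo-cong d (λ { (suc j) _ j<d → +-∸-assoc 1 (<⇒≤ j<d) }))
                   (trans (+-∸-assoc 1 (≤-refl {d})) (cong suc (n∸n≡0 d))) ⟩
    sumTo (λ j → 1 + (d ∸ pred j)) d + 1
      ≡⟨ cong (_+ 1) (sumTo-+ (λ _ → 1) _ d) ⟩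
    sumTo (λ _ → 1) d + sumTo (λ j → d ∸ pred j) d + 1
      ≡⟨ cong₂ (λ u v → u + v + 1) (sumTo-const 1 d) (descending d) ⟩
    d * 1 + tri (suc d) + 1
      ≡⟨ rearrange d (tri (suc d)) ⟩
    tri (suc d) + suc d ∎
    where
    open ≡-Reasoning
    rearrange : ∀ d T → d * 1 + T + 1 ≡ T + suc d
    rearrange = solve-∀

  lowHigh-short : ∀ s c → c ≤ suc s → lowHigh s c ≡ tri c
  lowHigh-short s c c≤ =
    trans (sumTo-cong c (λ { (suc j) _ j<c → m≥n⇒m⊓n≡n (s≤s⁻¹ (≤-trans j<c c≤)) })) (sumTo-pred∸ 0 c)

  lowHigh-long : ∀ s e → lowHigh s (s + e) ≡ tri s + e * s
  lowHigh-long s e = trans (sumTo-split _ s e) (cong₂ _+_ first-s rest)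
    where
    first-s : sumTo (λ j → s ⊓ pred j) s ≡ tri s
    first-s = trans (sumTo-cong s (λ { (suc j) _ j<s → m≥n⇒m⊓n≡n (<⇒≤ j<s) })) (sumTo-pred∸ 0 s)
    rest : sumTo (λ j → s ⊓ pred (s + j)) e ≡ e * s
    rest = trans (sumTo-cong e (λ { (suc j) _ _ →
                   trans (cong (λ w → s ⊓ pred w) (+-suc s j)) (m≤n⇒m⊓n≡m (m≤m+n s j)) }))
                 (sumTo-const s e)

  lowLow-vanishes : ∀ s b c → s ≤ b → lowLow s b c ≡ 0
  lowLow-vanishes s b c s≤b =
    trans (sumTo-cong c (λ j _ _ → m≤n⇒m∸n≡0 (≤-trans s≤b (m≤m+n b (pred j)))))
          (trans (sumTo-const 0 c) (*-zeroʳ c))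

  lowLow-lower : ∀ s b c → b ≤ s → s ∸ b ≤ c → tri (suc (s ∸ b)) ≤ lowLow s b c
  lowLow-lower s b c b≤s d≤c = begin
    tri (suc d)                                      ≡⟨ sym (descending d) ⟩
    sumTo (λ j → d ∸ pred j) d                       ≡⟨ sumTo-cong d (λ j _ _ → ∸-+-assoc s b (pred j)) ⟩
    sumTo f d                                        ≤⟨ m≤m+n (sumTo f d) _ ⟩
    sumTo f d + sumTo (λ j → f (d + j)) (c ∸ d)      ≡⟨ sym (sumTo-split f d (c ∸ d)) ⟩
    sumTo f (d + (c ∸ d))                            ≡⟨ cong (sumTo f) (m+[n∸m]≡n d≤c) ⟩
    lowLow s b c                                     ∎
    where
    open ≤-Reasoning
    d = s ∸ b
    f = λ j → s ∸ (b + pred j)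

  M-short-top : ∀ a v c → c ≤ suc a →
    M (a + (a + v) + c) a (a + (a + v)) ≡ tri a + tri v + 2 * tri c
  M-short-top a v c c≤ = begin
    M (a + (a + v) + c) a (a + (a + v))
      ≡⟨ M-closed a (a + v) c ⟩
    tri a + tri (a + v ∸ a) + lowLow a (a + v) c + 2 * lowHigh a c + tri (c ∸ (a + (a + v)))
      ≡⟨ cong₂ (λ u w → tri a + tri u + w + 2 * lowHigh a c + tri (c ∸ (a + (a + v))))
               (m+n∸m≡n a v) (lowLow-vanishes a (a + v) c (m≤m+n a v)) ⟩
    tri a + tri v + 0 + 2 * lowHigh a c + tri (c ∸ (a + (a + v)))
      ≡⟨ cong₂ (λ u w → tri a + tri v + 0 + 2 * u + w) (lowHigh-short a c c≤) (tri-small _ top≤1) ⟩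
    tri a + tri v + 0 + 2 * tri c + 0
      ≡⟨ drop-zeros (tri a) (tri v) (tri c) ⟩
    tri a + tri v + 2 * tri c ∎
    where
    open ≡-Reasoning
    top≤1 : c ∸ (a + (a + v)) ≤ 1
    top≤1 = m≤n+o⇒m∸n≤o c (a + (a + v)) (≤-trans c≤ (≤-trans (s≤s (m≤m+n a (a + v))) (≤-reflexive (+-comm 1 _))))
    drop-zeros : ∀ x y z → x + y + 0 + 2 * z + 0 ≡ x + y + 2 * z
    drop-zeros = solve-∀


module Positivity where

  import Data.Nat as ℕ
  open ℕ using (ℕ; zero; suc)
  open import Data.Integer using (+_; -[1+_]; 0ℤ; _+_; _*_; _≤_; +≤+)
  open import Data.Integer.Properties using (+◃n≡+n)

  -- Combinators certifying that an integer expression is non-negative; a sum-of-squares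
  -- certificate  0 ≤ k₁ * p₁ + ⋯ + kᵣ * pᵣ  is written  k₁ ⊛ P₁ ⊕ ⋯ ⊕ kᵣ ⊛ Pᵣ.
  infixl 5 _⊕_
  infixr 6 _⊛_
  infixl 7 _⊗_

  0≤+ : ∀ n → 0ℤ ≤ + n
  0≤+ n = +≤+ ℕ.z≤n

  _⊕_ : ∀ {x y} → 0ℤ ≤ x → 0ℤ ≤ y → 0ℤ ≤ x + y
  +≤+ {n = m} _ ⊕ +≤+ {n = n} _ = 0≤+ (m ℕ.+ n)

  _⊗_ : ∀ {x y} → 0ℤ ≤ x → 0ℤ ≤ y → 0ℤ ≤ x * y
  +≤+ {n = m} _ ⊗ +≤+ {n = n} _ rewrite +◃n≡+n (m ℕ.* n) = 0≤+ (m ℕ.* n)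

  _⊛_ : ∀ k {x} → 0ℤ ≤ x → 0ℤ ≤ + k * x
  k ⊛ h = 0≤+ k ⊗ h

  square : ∀ x → 0ℤ ≤ x * x
  square (+ n) rewrite +◃n≡+n (n ℕ.* n) = 0≤+ _
  square -[1+ n ] = 0≤+ _

  consecutive : ∀ x → 0ℤ ≤ x * (x + + 1)
  consecutive (+ n) rewrite +◃n≡+n (n ℕ.* (n ℕ.+ 1)) = 0≤+ _
  consecutive -[1+ zero ]  = 0≤+ 0
  consecutive -[1+ suc n ] = 0≤+ _

  cancel : ∀ d {g} → 0ℤ ≤ + suc d * g → 0ℤ ≤ g
  cancel d {+ n}      _ = 0≤+ n
  cancel d { -[1+ n ]} ()


module IntegerModel where

  import Data.Nat as ℕ
  open ℕ using (ℕ; suc)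
  import Data.Nat.Properties as ℕ
  open import Data.Integer using (ℤ; +_; 0ℤ; _+_; _*_; _-_; _≤_; +≤+)
  open import Data.Integer.Properties using (pos-+; pos-*; [+m]-[+n]≡m⊖n; ⊖-≥; i≤j⇒0≤j-i; 0≤i-j⇒j≤i)
  open import Data.Integer.Tactic.RingSolver using (solve-∀)
  import Data.Nat.Tactic.RingSolver as NatSolver
  open import Relation.Binary.PropositionalEquality
  open ≡-Reasoning

  open ClosedForm
  open Estimates
  open Positivity

  tri₂ : ℤ → ℤ
  tri₂ z = z * (z - + 1)

  -- The quadratic model: twice the number of monochromatic triples of a colouring with
  -- low block a, blue block exceeding it by v, and top block c, when no other triples occur.
  Λ : ℤ → ℤ → ℤ → ℤ
  Λ a v c = tri₂ a + tri₂ v + + 2 * tri₂ c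

  -- The threshold 2 N² - 8 N + 12, which 11 times every large value of 2 M exceeds.
  Θ : ℤ → ℤ
  Θ N = + 2 * (N * N) - + 8 * N + + 12

  tri-cast : ∀ x → + (2 ℕ.* tri x) ≡ tri₂ (+ x)
  tri-cast x = begin
    + (2 ℕ.* tri x)                    ≡⟨ add-sub (+ (2 ℕ.* tri x)) (+ x) ⟩
    (+ (2 ℕ.* tri x) + + x) - + x      ≡⟨ cong (_- + x) (sym (pos-+ (2 ℕ.* tri x) x)) ⟩
    + (2 ℕ.* tri x ℕ.+ x) - + x        ≡⟨ cong (λ w → + w - + x) (tri-square x) ⟩
    + (x ℕ.* x) - + x                  ≡⟨ cong (_- + x) (pos-* x x) ⟩
    + x * + x - + x                    ≡⟨ factor (+ x) ⟩
    tri₂ (+ x)                         ∎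
    where
    add-sub : ∀ u v → u ≡ (u + v) - v
    add-sub = solve-∀
    factor : ∀ z → z * z - z ≡ z * (z - + 1)
    factor = solve-∀

  ∸-cast : ∀ {x y} → y ℕ.≤ x → + (x ℕ.∸ y) ≡ + x - + y
  ∸-cast {x} {y} y≤x = sym (trans ([+m]-[+n]≡m⊖n x y) (⊖-≥ y≤x))

  ≤-cast : ∀ {x y} → x ℕ.≤ y → 0ℤ ≤ + y - + x
  ≤-cast x≤y = i≤j⇒0≤j-i (+≤+ x≤y)

  ≤-by : ∀ {x y} r → y ≡ x + r → 0ℤ ≤ r → x ≤ y
  ≤-by {x} {y} r y≡x+r 0≤r = 0≤i-j⇒j≤i (subst (0ℤ ≤_) (sym (trans (cong (_- x) y≡x+r) (cancel-x x r))) 0≤r)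
    where
    cancel-x : ∀ x r → (x + r) - x ≡ r
    cancel-x = solve-∀

  module TwiceM (a b c : ℕ) where

    twiceM blue lowPairs mixedPairs top : ℤ
    twiceM     = + (2 ℕ.* M (a ℕ.+ b ℕ.+ c) a (a ℕ.+ b))
    blue       = + (2 ℕ.* tri (b ℕ.∸ a))
    lowPairs   = + (2 ℕ.* lowLow a b c)
    mixedPairs = + (2 ℕ.* lowHigh a c)
    top        = + (2 ℕ.* tri (c ℕ.∸ (a ℕ.+ b)))

    decomposition : twiceM ≡ tri₂ (+ a) + blue + lowPairs + + 2 * mixedPairs + top
    decomposition = begin
      twiceM
        ≡⟨ cong (λ w → + (2 ℕ.* w)) (M-closed a b c) ⟩
      + (2 ℕ.* (tri a ℕ.+ tri (b ℕ.∸ a) ℕ.+ lowLow a b c ℕ.+ 2 ℕ.* lowHigh a c ℕ.+ tri (c ℕ.∸ (a ℕ.+ b))))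
        ≡⟨ cong +_ (distribute (tri a) (tri (b ℕ.∸ a)) (lowLow a b c) (lowHigh a c) (tri (c ℕ.∸ (a ℕ.+ b)))) ⟩
      + (A ℕ.+ B ℕ.+ P ℕ.+ 2 ℕ.* Q ℕ.+ L)
        ≡⟨ pos-+ (A ℕ.+ B ℕ.+ P ℕ.+ 2 ℕ.* Q) L ⟩
      + (A ℕ.+ B ℕ.+ P ℕ.+ 2 ℕ.* Q) + + L
        ≡⟨ cong (_+ + L) (pos-+ (A ℕ.+ B ℕ.+ P) (2 ℕ.* Q)) ⟩
      + (A ℕ.+ B ℕ.+ P) + + (2 ℕ.* Q) + + L
        ≡⟨ cong₂ (λ u v → u + v + + L)
             (trans (pos-+ (A ℕ.+ B) P) (cong (_+ + P) (trans (pos-+ A B) (cong (_+ + B) (tri-cast a)))))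
             (pos-* 2 Q) ⟩
      tri₂ (+ a) + blue + lowPairs + + 2 * mixedPairs + top ∎
      where
      A B P Q L : ℕ
      A = 2 ℕ.* tri a
      B = 2 ℕ.* tri (b ℕ.∸ a)
      P = 2 ℕ.* lowLow a b c
      Q = 2 ℕ.* lowHigh a c
      L = 2 ℕ.* tri (c ℕ.∸ (a ℕ.+ b))
      distribute : ∀ x y z q w → 2 ℕ.* (x ℕ.+ y ℕ.+ z ℕ.+ 2 ℕ.* q ℕ.+ w)
                               ≡ 2 ℕ.* x ℕ.+ 2 ℕ.* y ℕ.+ 2 ℕ.* z ℕ.+ 2 ℕ.* (2 ℕ.* q) ℕ.+ 2 ℕ.* w
      distribute = NatSolver.solve-∀

    blue≥0 : 0ℤ ≤ blue
    blue≥0 = 0≤+ _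
    lowPairs≥0 : 0ℤ ≤ lowPairs
    lowPairs≥0 = 0≤+ _
    mixedPairs≥0 : 0ℤ ≤ mixedPairs
    mixedPairs≥0 = 0≤+ _
    top≥0 : 0ℤ ≤ top
    top≥0 = 0≤+ _

    blue-long : a ℕ.≤ b → blue ≡ tri₂ (+ b - + a)
    blue-long a≤b = trans (tri-cast (b ℕ.∸ a)) (cong tri₂ (∸-cast a≤b))

    blue-short : b ℕ.< a → blue ≡ + 0
    blue-short b<a = cong (λ w → + (2 ℕ.* tri w)) (ℕ.m≤n⇒m∸n≡0 (ℕ.<⇒≤ b<a))

    top-long : a ℕ.+ b ℕ.≤ c → top ≡ tri₂ (+ c - (+ a + + b))
    top-long a+b≤c = trans (tri-cast (c ℕ.∸ (a ℕ.+ b))) (cong tri₂ (∸-cast a+b≤c))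

    mixed-short : c ℕ.≤ suc a → mixedPairs ≡ tri₂ (+ c)
    mixed-short c≤ = trans (cong (λ w → + (2 ℕ.* w)) (lowHigh-short a c c≤)) (tri-cast c)

    mixed-long : a ℕ.< c → mixedPairs ≡ tri₂ (+ a) + + 2 * ((+ c - + a) * + a)
    mixed-long a<c = begin
      + (2 ℕ.* lowHigh a c)
        ≡⟨ cong (λ w → + (2 ℕ.* lowHigh a w)) (sym (ℕ.m+[n∸m]≡n (ℕ.<⇒≤ a<c))) ⟩
      + (2 ℕ.* lowHigh a (a ℕ.+ e))
        ≡⟨ cong (λ w → + (2 ℕ.* w)) (lowHigh-long a e) ⟩
      + (2 ℕ.* (tri a ℕ.+ e ℕ.* a))
        ≡⟨ cong +_ (ℕ.*-distribˡ-+ 2 (tri a) (e ℕ.* a)) ⟩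
      + (2 ℕ.* tri a ℕ.+ 2 ℕ.* (e ℕ.* a))
        ≡⟨ pos-+ (2 ℕ.* tri a) (2 ℕ.* (e ℕ.* a)) ⟩
      + (2 ℕ.* tri a) + + (2 ℕ.* (e ℕ.* a))
        ≡⟨ cong₂ _+_ (tri-cast a)
             (trans (pos-* 2 (e ℕ.* a)) (cong (+ 2 *_) (trans (pos-* e a) (cong (_* + a) (∸-cast (ℕ.<⇒≤ a<c)))))) ⟩
      tri₂ (+ a) + + 2 * ((+ c - + a) * + a) ∎
      where
      e = c ℕ.∸ a

    -- When the blue block is shorter than the low one, the low/low pairs make up for the
    -- missing blue triples: tri₂ (a - b + 1) = tri₂ (b - a).
    lowPairs-lower : b ℕ.< a → a ℕ.∸ b ℕ.≤ c → tri₂ (+ b - + a) ≤ lowPairs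
    lowPairs-lower b<a d≤c =
      subst (_≤ lowPairs) reflected (+≤+ (ℕ.*-monoʳ-≤ 2 (lowLow-lower a b c (ℕ.<⇒≤ b<a) d≤c)))
      where
      reflect : ∀ x y → (+ 1 + (x - y)) * ((+ 1 + (x - y)) - + 1) ≡ (y - x) * ((y - x) - + 1)
      reflect = solve-∀
      reflected : + (2 ℕ.* tri (suc (a ℕ.∸ b))) ≡ tri₂ (+ b - + a)
      reflected = trans (tri-cast (suc (a ℕ.∸ b)))
                        (trans (cong (λ w → tri₂ (+ 1 + w)) (∸-cast (ℕ.<⇒≤ b<a))) (reflect (+ a) (+ b)))

    model-below-A : a ℕ.≤ b → c ℕ.≤ suc a → Λ (+ a) (+ b - + a) (+ c) ≤ twiceM
    model-below-A a≤b c≤ =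
      ≤-by (lowPairs + top)
        (trans decomposition (trans (cong₂ (λ u v → tri₂ (+ a) + u + lowPairs + + 2 * v + top)
                                            (blue-long a≤b) (mixed-short c≤))
                                    (regroup (+ a) (+ b) (+ c) lowPairs top)))
        (lowPairs≥0 ⊕ top≥0)
      where
      regroup : ∀ a b c P L → a * (a - + 1) + (b - a) * ((b - a) - + 1) + P + + 2 * (c * (c - + 1)) + L
                            ≡ a * (a - + 1) + (b - a) * ((b - a) - + 1) + + 2 * (c * (c - + 1)) + (P + L)
      regroup = solve-∀

    model-below-B : b ℕ.< a → a ℕ.∸ b ℕ.≤ c → c ℕ.≤ suc a → Λ (+ a) (+ b - + a) (+ c) ≤ twiceM
    model-below-B b<a d≤c c≤ =
      ≤-by ((lowPairs - tri₂ (+ b - + a)) + top)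
        (trans decomposition (trans (cong₂ (λ u v → tri₂ (+ a) + u + lowPairs + + 2 * v + top)
                                            (blue-short b<a) (mixed-short c≤))
                                    (regroup (+ a) (+ b) (+ c) lowPairs top)))
        (i≤j⇒0≤j-i (lowPairs-lower b<a d≤c) ⊕ top≥0)
      where
      regroup : ∀ a b c P L → a * (a - + 1) + + 0 + P + + 2 * (c * (c - + 1)) + L
                            ≡ a * (a - + 1) + (b - a) * ((b - a) - + 1) + + 2 * (c * (c - + 1))
                              + ((P - (b - a) * ((b - a) - + 1)) + L)
      regroup = solve-∀

    -- Crude bounds, used where M is far from minimal.
    lower-C : tri₂ (+ a) ≤ twiceM
    lower-C = ≤-by (blue + lowPairs + + 2 * mixedPairs + top)
                (trans decomposition (regroup (tri₂ (+ a)) blue lowPairs mixedPairs top))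
                (blue≥0 ⊕ lowPairs≥0 ⊕ 2 ⊛ mixedPairs≥0 ⊕ top≥0)
      where
      regroup : ∀ A B P Q L → A + B + P + + 2 * Q + L ≡ A + (B + P + + 2 * Q + L)
      regroup = solve-∀

    lower-D1 : a ℕ.≤ b → a ℕ.< c → + 3 * tri₂ (+ a) + tri₂ (+ b - + a) + + 4 * + a * (+ c - + a) ≤ twiceM
    lower-D1 a≤b a<c =
      ≤-by (lowPairs + top)
        (trans decomposition (trans (cong₂ (λ u v → tri₂ (+ a) + u + lowPairs + + 2 * v + top)
                                            (blue-long a≤b) (mixed-long a<c))
                                    (regroup (+ a) (+ b) (+ c) lowPairs top)))
        (lowPairs≥0 ⊕ top≥0)
      where
      regroup : ∀ a b c P L → a * (a - + 1) + (b - a) * ((b - a) - + 1) + P + + 2 * (a * (a - + 1) + + 2 * ((c - a) * a)) + L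
                            ≡ + 3 * (a * (a - + 1)) + (b - a) * ((b - a) - + 1) + + 4 * a * (c - a) + (P + L)
      regroup = solve-∀

    lower-D2 : a ℕ.≤ b → a ℕ.< c → a ℕ.+ b ℕ.≤ c →
      + 3 * tri₂ (+ a) + tri₂ (+ b - + a) + + 4 * + a * (+ c - + a) + tri₂ (+ c - (+ a + + b)) ≤ twiceM
    lower-D2 a≤b a<c a+b≤c =
      ≤-by lowPairs
        (trans decomposition (trans (cong₂ (λ u v → tri₂ (+ a) + u + lowPairs + + 2 * v + top)
                                            (blue-long a≤b) (mixed-long a<c))
                            (trans (cong (λ w → tri₂ (+ a) + tri₂ (+ b - + a) + lowPairs + + 2 * (tri₂ (+ a) + + 2 * ((+ c - + a) * + a)) + w)
                                         (top-long a+b≤c))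
                                   (regroup (+ a) (+ b) (+ c) lowPairs))))
        lowPairs≥0
      where
      regroup : ∀ a b c P → a * (a - + 1) + (b - a) * ((b - a) - + 1) + P + + 2 * (a * (a - + 1) + + 2 * ((c - a) * a))
                              + (c - (a + b)) * ((c - (a + b)) - + 1)
                          ≡ + 3 * (a * (a - + 1)) + (b - a) * ((b - a) - + 1) + + 4 * a * (c - a)
                              + (c - (a + b)) * ((c - (a + b)) - + 1) + P
      regroup = solve-∀

    lower-D3 : b ℕ.< a → a ℕ.< c → + 3 * tri₂ (+ a) + + 4 * + a * (+ c - + a) ≤ twiceM
    lower-D3 b<a a<c =
      ≤-by (lowPairs + top)
        (trans decomposition (trans (cong₂ (λ u v → tri₂ (+ a) + u + lowPairs + + 2 * v + top)
                                            (blue-short b<a) (mixed-long a<c))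
                                    (regroup (+ a) (+ c) lowPairs top)))
        (lowPairs≥0 ⊕ top≥0)
      where
      regroup : ∀ a c P L → a * (a - + 1) + + 0 + P + + 2 * (a * (a - + 1) + + 2 * ((c - a) * a)) + L
                          ≡ + 3 * (a * (a - + 1)) + + 4 * a * (c - a) + (P + L)
      regroup = solve-∀

    lower-D4 : b ℕ.< a → a ℕ.< c → a ℕ.+ b ℕ.≤ c →
      + 3 * tri₂ (+ a) + + 4 * + a * (+ c - + a) + tri₂ (+ c - (+ a + + b)) ≤ twiceM
    lower-D4 b<a a<c a+b≤c =
      ≤-by lowPairs
        (trans decomposition (trans (cong₂ (λ u v → tri₂ (+ a) + u + lowPairs + + 2 * v + top)
                                            (blue-short b<a) (mixed-long a<c))
                            (trans (cong (λ w → tri₂ (+ a) + + 0 + lowPairs + + 2 * (tri₂ (+ a) + + 2 * ((+ c - + a) * + a)) + w)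
                                         (top-long a+b≤c))
                                   (regroup (+ a) (+ b) (+ c) lowPairs))))
        lowPairs≥0
      where
      regroup : ∀ a b c P → a * (a - + 1) + + 0 + P + + 2 * (a * (a - + 1) + + 2 * ((c - a) * a))
                              + (c - (a + b)) * ((c - (a + b)) - + 1)
                          ≡ + 3 * (a * (a - + 1)) + + 4 * a * (c - a) + (c - (a + b)) * ((c - (a + b)) - + 1) + P
      regroup = solve-∀


-- Where M is far from minimal, 11 · 2 M exceeds the threshold Θ.
module Regions where

  open import Data.Integer using (+_; 0ℤ; _+_; _*_; _-_; _≤_)
  open import Data.Integer.Properties using (0≤i-j⇒j≤i)
  open import Data.Integer.Tactic.RingSolver using (solve-∀)
  open import Relation.Binary.PropositionalEquality using (_≡_; subst; sym)

  open Positivity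
  open IntegerModel

  certificate-D1 : ∀ a b c →
    + 198 * (+ 11 * (+ 3 * (a * (a - + 1)) + (b - a) * ((b - a) - + 1) + + 4 * a * (c - a))
             - (+ 2 * ((a + b + c) * (a + b + c)) - + 8 * (a + b + c) + + 12))
    ≡ + 2079 * (a * a) + + 324 * ((b - a) * (c - (a + + 1))) + + 3204 * ((c - (a + + 1)) * ((a + b) - c))
      + + 546 * a + + 804 * ((a + b + c) - + 5) + + 7 * ((b - + 2 * c - + 3) * (b - + 2 * c - + 3))
      + + 78 * ((b - + 2 * c - + 2) * (b - + 2 * c - + 2)) + + 77 * ((b - + 2 * c) * (b - + 2 * c))
      + + 297 * ((a - + 2 * b + + 2 * c - + 1) * (a - + 2 * b + + 2 * c - + 1))
      + + 108 * ((a - + 2 * b + + 3 * c - + 3) * (a - + 2 * b + + 3 * c - + 3))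
  certificate-D1 = solve-∀

  region-D1 : ∀ a b c →
    0ℤ ≤ a → 0ℤ ≤ b - a → 0ℤ ≤ c - (a + + 1) → 0ℤ ≤ (a + b) - c → 0ℤ ≤ (a + b + c) - + 5 →
    Θ (a + b + c) ≤ + 11 * (+ 3 * tri₂ a + tri₂ (b - a) + + 4 * a * (c - a))
  region-D1 a b c a≥0 b≥a c>a a+b≥c N≥5 = 0≤i-j⇒j≤i (cancel 197 (subst (0ℤ ≤_) (sym (certificate-D1 a b c))
    (2079 ⊛ a≥0 ⊗ a≥0 ⊕ 324 ⊛ b≥a ⊗ c>a ⊕ 3204 ⊛ c>a ⊗ a+b≥c ⊕ 546 ⊛ a≥0 ⊕ 804 ⊛ N≥5
     ⊕ 7 ⊛ square (b - + 2 * c - + 3) ⊕ 78 ⊛ square (b - + 2 * c - + 2) ⊕ 77 ⊛ square (b - + 2 * c)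
     ⊕ 297 ⊛ square (a - + 2 * b + + 2 * c - + 1) ⊕ 108 ⊛ square (a - + 2 * b + + 3 * c - + 3))))

  certificate-D2 : ∀ a b c →
    + 3 * (+ 11 * (+ 3 * (a * (a - + 1)) + (b - a) * ((b - a) - + 1) + + 4 * a * (c - a)
                   + (c - (a + b)) * ((c - (a + b)) - + 1))
           - (+ 2 * ((a + b + c) * (a + b + c)) - + 8 * (a + b + c) + + 12))
    ≡ + 123 * (a * a) + + 42 * (a * (b - a)) + + 54 * (a * (c - (a + b + + 1))) + + 34 * a
      + + 11 * ((a + b + c) - + 5) + + 1 * ((+ 2 * b - c - + 1) * (+ 2 * b - c - + 1))
      + + 3 * ((+ 3 * b - + 2 * c) * (+ 3 * b - + 2 * c)) + + 9 * ((b - c + + 1) * ((b - c + + 1) + + 1))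
      + + 5 * ((+ 2 * b - c - + 1) * ((+ 2 * b - c - + 1) + + 1))
  certificate-D2 = solve-∀

  region-D2 : ∀ a b c → 0ℤ ≤ a → 0ℤ ≤ b - a → 0ℤ ≤ c - (a + b + + 1) → 0ℤ ≤ (a + b + c) - + 5 →
    Θ (a + b + c) ≤ + 11 * (+ 3 * tri₂ a + tri₂ (b - a) + + 4 * a * (c - a) + tri₂ (c - (a + b)))
  region-D2 a b c a≥0 b≥a c>a+b N≥5 = 0≤i-j⇒j≤i (cancel 2 (subst (0ℤ ≤_) (sym (certificate-D2 a b c))
    (123 ⊛ a≥0 ⊗ a≥0 ⊕ 42 ⊛ a≥0 ⊗ b≥a ⊕ 54 ⊛ a≥0 ⊗ c>a+b ⊕ 34 ⊛ a≥0 ⊕ 11 ⊛ N≥5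
     ⊕ 1 ⊛ square (+ 2 * b - c - + 1) ⊕ 3 ⊛ square (+ 3 * b - + 2 * c)
     ⊕ 9 ⊛ consecutive (b - c + + 1) ⊕ 5 ⊛ consecutive (+ 2 * b - c - + 1))))

  certificate-D3 : ∀ a b c →
    + 11 * (+ 3 * (a * (a - + 1)) + + 4 * a * (c - a))
      - (+ 2 * ((a + b + c) * (a + b + c)) - + 8 * (a + b + c) + + 12)
    ≡ + 42 * (b * (a - (b + + 1))) + + 45 * (b * (c - (a + + 1))) + + 25 * ((a - (b + + 1)) * (a - (b + + 1)))
      + + 36 * ((a - (b + + 1)) * (c - (a + + 1))) + + 17 * ((c - (a + + 1)) * ((a + b) - c))
      + + 15 * (((a + b) - c) * ((a + b) - c)) + + 95 * b + + 69 * (a - (b + + 1)) + + 27 * (c - (a + + 1)) + + 23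
  certificate-D3 = solve-∀

  region-D3 : ∀ a b c → 0ℤ ≤ b → 0ℤ ≤ a - (b + + 1) → 0ℤ ≤ c - (a + + 1) → 0ℤ ≤ (a + b) - c →
    Θ (a + b + c) ≤ + 11 * (+ 3 * tri₂ a + + 4 * a * (c - a))
  region-D3 a b c b≥0 a>b c>a a+b≥c = 0≤i-j⇒j≤i (subst (0ℤ ≤_) (sym (certificate-D3 a b c))
    (42 ⊛ b≥0 ⊗ a>b ⊕ 45 ⊛ b≥0 ⊗ c>a ⊕ 25 ⊛ a>b ⊗ a>b ⊕ 36 ⊛ a>b ⊗ c>a ⊕ 17 ⊛ c>a ⊗ a+b≥c
     ⊕ 15 ⊛ a+b≥c ⊗ a+b≥c ⊕ 95 ⊛ b≥0 ⊕ 69 ⊛ a>b ⊕ 27 ⊛ c>a ⊕ 0≤+ 23))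

  certificate-D4 : ∀ a b c →
    + 11 * (+ 3 * (a * (a - + 1)) + + 4 * a * (c - a) + (c - (a + b)) * ((c - (a + b)) - + 1))
      - (+ 2 * ((a + b + c) * (a + b + c)) - + 8 * (a + b + c) + + 12)
    ≡ + 45 * (b * b) + + 78 * (b * (a - (b + + 1))) + + 28 * (b * (c - (a + b)))
      + + 25 * ((a - (b + + 1)) * (a - (b + + 1))) + + 36 * ((a - (b + + 1)) * (c - (a + b)))
      + + 9 * ((c - (a + b)) * (c - (a + b))) + + 73 * b + + 33 * (a - (b + + 1)) + + 29 * (c - (a + b))
      + + 4 * (c - (a + + 1))
  certificate-D4 = solve-∀

  region-D4 : ∀ a b c → 0ℤ ≤ b → 0ℤ ≤ a - (b + + 1) → 0ℤ ≤ c - (a + b) → 0ℤ ≤ c - (a + + 1) →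
    Θ (a + b + c) ≤ + 11 * (+ 3 * tri₂ a + + 4 * a * (c - a) + tri₂ (c - (a + b)))
  region-D4 a b c b≥0 a>b c≥a+b c>a = 0≤i-j⇒j≤i (subst (0ℤ ≤_) (sym (certificate-D4 a b c))
    (45 ⊛ b≥0 ⊗ b≥0 ⊕ 78 ⊛ b≥0 ⊗ a>b ⊕ 28 ⊛ b≥0 ⊗ c≥a+b ⊕ 25 ⊛ a>b ⊗ a>b ⊕ 36 ⊛ a>b ⊗ c≥a+b
     ⊕ 9 ⊛ c≥a+b ⊗ c≥a+b ⊕ 73 ⊛ b≥0 ⊕ 33 ⊛ a>b ⊕ 29 ⊛ c≥a+b ⊕ 4 ⊛ c>a))

  certificate-C : ∀ a b c →
    + 2 * (+ 11 * (a * (a - + 1)) - (+ 2 * ((a + b + c) * (a + b + c)) - + 8 * (a + b + c) + + 12))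
    ≡ + 6 * (b * b) + + 12 * (b * c) + + 28 * (b * (a - (b + c + + 1))) + + 6 * (c * c)
      + + 28 * (c * (a - (b + c + + 1))) + + 18 * ((a - (b + c + + 1)) * (a - (b + c + + 1)))
      + + 32 * b + + 32 * c + + 27 * (a - (b + c + + 1)) + + 3 * ((a + b + c) - + 5)
  certificate-C = solve-∀

  region-C : ∀ a b c → 0ℤ ≤ b → 0ℤ ≤ c → 0ℤ ≤ a - (b + c + + 1) → 0ℤ ≤ (a + b + c) - + 5 →
    Θ (a + b + c) ≤ + 11 * tri₂ a
  region-C a b c b≥0 c≥0 a>b+c N≥5 = 0≤i-j⇒j≤i (cancel 1 (subst (0ℤ ≤_) (sym (certificate-C a b c))
    (6 ⊛ b≥0 ⊗ b≥0 ⊕ 12 ⊛ b≥0 ⊗ c≥0 ⊕ 28 ⊛ b≥0 ⊗ a>b+c ⊕ 6 ⊛ c≥0 ⊗ c≥0 ⊕ 28 ⊛ c≥0 ⊗ a>b+c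
     ⊕ 18 ⊛ a>b+c ⊗ a>b+c ⊕ 32 ⊛ b≥0 ⊕ 32 ⊛ c≥0 ⊕ 27 ⊛ a>b+c ⊕ 3 ⊛ N≥5)))


module Dichotomy where

  import Data.Nat as ℕ
  open ℕ using (ℕ)
  import Data.Nat.Properties as ℕ
  open import Data.Integer using (ℤ; +_; 0ℤ; _+_; _*_; _-_; _≤_)
  open import Data.Integer.Properties using (≤-trans; *-monoˡ-≤-nonNeg; *-cancelˡ-≤-pos)
  open import Data.Sum using (_⊎_; inj₁; inj₂)
  open import Relation.Nullary using (yes; no)
  open import Relation.Binary.PropositionalEquality

  open Positivity
  open IntegerModel
  open Regions
  open TwiceM

  <-cast : ∀ {x y} → x ℕ.< y → 0ℤ ≤ + y - (+ x + + 1)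
  <-cast {x} x<y = ≤-cast (ℕ.≤-trans (ℕ.≤-reflexive (ℕ.+-comm x 1)) x<y)

  transfer : ∀ {Θ′ L X} → L ≤ X → Θ′ ≤ + 11 * L → Θ′ ≤ + 11 * X
  transfer L≤X Θ′≤11L = ≤-trans Θ′≤11L (*-monoˡ-≤-nonNeg (+ 11) L≤X)

  -- For c ≤ a the shapes a ≤ b and a - b ≤ c < a
  -- are above the model and the shape b + c < a is large; for a < c all shapes are large.
  dichotomy : ∀ a b c → 5 ℕ.≤ a ℕ.+ b ℕ.+ c →
    Λ (+ a) (+ b - + a) (+ c) ≤ twiceM a b c ⊎ Θ (+ a + + b + + c) ≤ + 11 * twiceM a b c
  dichotomy a b c N≥5 with a ℕ.<? c | a ℕ.≤? b
  ... | no a≮c | yes a≤b = inj₁ (model-below-A a b c a≤b c≤a+1)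
    where c≤a+1 = ℕ.≤-trans (ℕ.≮⇒≥ a≮c) (ℕ.n≤1+n a)
  ... | no a≮c | no a≰b with a ℕ.∸ b ℕ.≤? c
  ...   | yes a-b≤c = inj₁ (model-below-B a b c (ℕ.≰⇒> a≰b) a-b≤c c≤a+1)
    where c≤a+1 = ℕ.≤-trans (ℕ.≮⇒≥ a≮c) (ℕ.n≤1+n a)
  ...   | no a-b≰c = inj₂ (transfer (lower-C a b c)
                             (region-C (+ a) (+ b) (+ c) (0≤+ b) (0≤+ c) (≤-cast b+c<a) (≤-cast N≥5)))
    where
    b+c<a : b ℕ.+ c ℕ.+ 1 ℕ.≤ a
    b+c<a = ℕ.≤-trans (ℕ.≤-reflexive (trans (ℕ.+-assoc b c 1) (cong (b ℕ.+_) (ℕ.+-comm c 1))))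
                      (ℕ.≤-trans (ℕ.+-monoʳ-≤ b (ℕ.≰⇒> a-b≰c)) (ℕ.≤-reflexive (ℕ.m+[n∸m]≡n (ℕ.<⇒≤ (ℕ.≰⇒> a≰b)))))
  dichotomy a b c N≥5 | yes a<c | yes a≤b with c ℕ.≤? a ℕ.+ b
  ... | yes c≤a+b = inj₂ (transfer (lower-D1 a b c a≤b a<c)
                            (region-D1 (+ a) (+ b) (+ c) (0≤+ a) (≤-cast a≤b) (<-cast a<c) (≤-cast c≤a+b) (≤-cast N≥5)))
  ... | no c≰a+b = inj₂ (transfer (lower-D2 a b c a≤b a<c (ℕ.<⇒≤ (ℕ.≰⇒> c≰a+b)))
                            (region-D2 (+ a) (+ b) (+ c) (0≤+ a) (≤-cast a≤b) (<-cast (ℕ.≰⇒> c≰a+b)) (≤-cast N≥5)))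
  dichotomy a b c N≥5 | yes a<c | no a≰b with c ℕ.≤? a ℕ.+ b
  ... | yes c≤a+b = inj₂ (transfer (lower-D3 a b c (ℕ.≰⇒> a≰b) a<c)
                            (region-D3 (+ a) (+ b) (+ c) (0≤+ b) (<-cast (ℕ.≰⇒> a≰b)) (<-cast a<c) (≤-cast c≤a+b)))
  ... | no c≰a+b = inj₂ (transfer (lower-D4 a b c (ℕ.≰⇒> a≰b) a<c (ℕ.<⇒≤ (ℕ.≰⇒> c≰a+b)))
                            (region-D4 (+ a) (+ b) (+ c) (0≤+ b) (<-cast (ℕ.≰⇒> a≰b))
                                       (≤-cast (ℕ.<⇒≤ (ℕ.≰⇒> c≰a+b))) (<-cast a<c)))

  lower-bound : ∀ n (F : ℤ) → 5 ℕ.≤ n →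
    (∀ a b c → a + b + c ≡ + n → F ≤ Λ a (b - a) c) →
    + 11 * F ≤ Θ (+ n) →
    ∀ s t → s ℕ.≤ t → t ℕ.≤ n → F ≤ + (2 ℕ.* M n s t)
  lower-bound n F n≥5 below-model below-threshold s t s≤t t≤n =
    subst (λ N → F ≤ + (2 ℕ.* M N s t)) s+b+c≡n
      (subst (λ T → F ≤ + (2 ℕ.* M (s ℕ.+ b ℕ.+ c) s T)) (ℕ.m+[n∸m]≡n s≤t) F≤twiceM)
    where
    b = t ℕ.∸ s
    c = n ℕ.∸ t
    s+b+c≡n : s ℕ.+ b ℕ.+ c ≡ n
    s+b+c≡n = trans (cong (ℕ._+ c) (ℕ.m+[n∸m]≡n s≤t)) (ℕ.m+[n∸m]≡n t≤n)
    F≤twiceM : F ≤ twiceM s b c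
    F≤twiceM with dichotomy s b c (subst (5 ℕ.≤_) (sym s+b+c≡n) n≥5)
    ... | inj₁ model≤ = ≤-trans (below-model (+ s) (+ b) (+ c) (cong +_ s+b+c≡n)) model≤
    ... | inj₂ Θ≤     = *-cancelˡ-≤-pos F (twiceM s b c) (+ 11)
                          (≤-trans below-threshold (subst (λ N → Θ N ≤ + 11 * twiceM s b c) (cong +_ s+b+c≡n) Θ≤))


module ModelMinimum where

  open import Data.Integer using (ℤ; +_; 0ℤ; _+_; _*_; _-_; _≤_)
  open import Data.Integer.Tactic.RingSolver using (solve-∀)
  open import Relation.Binary.PropositionalEquality

  open Positivity
  open IntegerModel

  -- 5x² + 4xy + 3y² + px + qy is the increment of Λ along the plane a + b + c = const.
  increment : ℤ → ℤ → ℤ → ℤ → ℤ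
  increment p q x y = + 5 * (x * x) + + 4 * (x * y) + + 3 * (y * y) + p * x + q * y

  -- On integer points the increment is non-negative as soon as the linear part can be split
  -- as (p - w) x + (q - w) y + w (x + y) with |p - w| ≤ 3, |q - w| ≤ 1, |w| ≤ 2: writing
  -- 5x² + 4xy + 3y² = 3x² + y² + 2(x + y)², each  k z² + u z  with |u| ≤ k is a combination
  -- of z (z + 1) and z (z - 1) with non-negative weights.
  increment-nonneg : ∀ p q w x y →
    0ℤ ≤ + 3 + (p - w) → 0ℤ ≤ + 3 - (p - w) → 0ℤ ≤ + 1 + (q - w) → 0ℤ ≤ + 1 - (q - w) →
    0ℤ ≤ + 2 + w → 0ℤ ≤ + 2 - w → 0ℤ ≤ increment p q x y
  increment-nonneg p q w x y u₊ u₋ v₊ v₋ w₊ w₋ = cancel 1 (subst (0ℤ ≤_) (sym (split p q w x y))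
    (u₊ ⊗ consecutive x ⊕ u₋ ⊗ consecutive (x - + 1) ⊕ v₊ ⊗ consecutive y ⊕ v₋ ⊗ consecutive (y - + 1)
     ⊕ w₊ ⊗ consecutive (x + y) ⊕ w₋ ⊗ consecutive (x + y - + 1)))
    where
    split : ∀ p q w x y →
      + 2 * (+ 5 * (x * x) + + 4 * (x * y) + + 3 * (y * y) + p * x + q * y)
      ≡ (+ 3 + (p - w)) * (x * (x + + 1)) + (+ 3 - (p - w)) * ((x - + 1) * ((x - + 1) + + 1))
        + (+ 1 + (q - w)) * (y * (y + + 1)) + (+ 1 - (q - w)) * ((y - + 1) * ((y - + 1) + + 1))
        + (+ 2 + w) * ((x + y) * ((x + y) + + 1)) + (+ 2 - w) * ((x + y - + 1) * ((x + y - + 1) + + 1))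
    split = solve-∀

  model-shift : ∀ A V C a c →
    Λ a (((A + (A + V) + C) - a - c) - a) c
    ≡ Λ A V C + increment (+ 2 * A - + 4 * V + + 1) (+ 4 * C - + 2 * V - + 1) (a - A) (c - C)
  model-shift = shift
    where
    -- the same identity with Λ unfolded, as required by the ring solver
    shift : ∀ A V C a c →
      a * (a - + 1) + (((A + (A + V) + C) - a - c) - a) * ((((A + (A + V) + C) - a - c) - a) - + 1)
        + + 2 * (c * (c - + 1))
      ≡ A * (A - + 1) + V * (V - + 1) + + 2 * (C * (C - + 1))
        + (+ 5 * ((a - A) * (a - A)) + + 4 * ((a - A) * (c - C)) + + 3 * ((c - C) * (c - C))
           + (+ 2 * A - + 4 * V + + 1) * (a - A) + (+ 4 * C - + 2 * V - + 1) * (c - C))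
    shift = solve-∀

  model-minimum : ∀ A V C w →
    let p = + 2 * A - + 4 * V + + 1 ; q = + 4 * C - + 2 * V - + 1 in
    0ℤ ≤ + 3 + (p - w) → 0ℤ ≤ + 3 - (p - w) → 0ℤ ≤ + 1 + (q - w) → 0ℤ ≤ + 1 - (q - w) →
    0ℤ ≤ + 2 + w → 0ℤ ≤ + 2 - w →
    ∀ a b c → a + b + c ≡ A + (A + V) + C → Λ A V C ≤ Λ a (b - a) c
  model-minimum A V C w u₊ u₋ v₊ v₋ w₊ w₋ a b c on-plane =
    ≤-by (increment p q (a - A) (c - C))
         (trans (cong (λ b′ → Λ a (b′ - a) c) b≡) (model-shift A V C a c))
         (increment-nonneg p q w (a - A) (c - C) u₊ u₋ v₊ v₋ w₊ w₋)
    where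
    p = + 2 * A - + 4 * V + + 1
    q = + 4 * C - + 2 * V - + 1
    b≡ : b ≡ (A + (A + V) + C) - a - c
    b≡ = trans (isolate a b c) (cong (λ N → N - a - c) on-plane)
      where
      isolate : ∀ a b c → b ≡ (a + b + c) - a - c
      isolate = solve-∀


module Minimiser where

  import Data.Nat as ℕ
  open ℕ using (ℕ; suc; _≤_; _<_; _/_; z≤n; s≤s)
  import Data.Nat.Properties as ℕ
  open import Data.Nat.DivMod using (m*n/n≡m; +-distrib-/-∣ʳ)
  open import Data.Nat.Divisibility using (n∣m*n)
  open import Data.Integer using (ℤ; +_; -[1+_]; 0ℤ; _+_; _*_; _-_; +≤+) renaming (_≤_ to _≤ℤ_)
  open import Data.Integer.Properties using (pos-+; pos-*; 0≤i-j⇒j≤i; drop‿+≤+)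
  open import Data.Integer.Tactic.RingSolver using (solve-∀)
  import Data.Nat.Tactic.RingSolver as NatSolver
  open import Relation.Binary.PropositionalEquality

  open ClosedForm
  open Estimates
  open IntegerModel
  open Dichotomy
  open ModelMinimum

  -- For n = r + 11 k the minimiser is the colouring R^(α + 4k) B^(α + β + 6k) R^(γ + k);
  -- an `Optimum r` records α, β, γ together with the numerical facts about residue r
  -- (all checked by evaluation) that make this work for every k.
  record Optimum (r : ℕ) : Set where
    constructor optimum
    field
      α β γ : ℕ
      w : ℤ
      r-split : r ≡ α ℕ.+ (α ℕ.+ β) ℕ.+ γ
      s₀-base : (4 ℕ.* r ℕ.+ 2) / 11 ≡ α
      t₀-base : (10 ℕ.* r) / 11 ≡ α ℕ.+ (α ℕ.+ β)
      top-short : γ ≤ suc α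
      -- slope conditions of `model-minimum`, with slopes p = 2α - 4β + 1 and q = 4γ - 2β - 1
      u₊ : 0ℤ ≤ℤ + 3 + ((+ 2 * + α - + 4 * + β + + 1) - w)
      u₋ : 0ℤ ≤ℤ + 3 - ((+ 2 * + α - + 4 * + β + + 1) - w)
      v₊ : 0ℤ ≤ℤ + 1 + ((+ 4 * + γ - + 2 * + β - + 1) - w)
      v₋ : 0ℤ ≤ℤ + 1 - ((+ 4 * + γ - + 2 * + β - + 1) - w)
      w₊ : 0ℤ ≤ℤ + 2 + w
      w₋ : 0ℤ ≤ℤ + 2 - w
      -- the gap to the threshold at k = 0; it does not depend on k
      threshold : 0ℤ ≤ℤ Θ (+ r) - + 11 * Λ (+ α) (+ β) (+ γ)

  -- A non-negativity fact about a closed integer expression, established by evaluation.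
  ✓ : ∀ {m} → 0ℤ ≤ℤ + m
  ✓ = +≤+ z≤n

  shift-/11 : ∀ m q → (m ℕ.+ q ℕ.* 11) / 11 ≡ m / 11 ℕ.+ q
  shift-/11 m q = trans (+-distrib-/-∣ʳ m (n∣m*n q)) (cong (m / 11 ℕ.+_) (m*n/n≡m q 11))

  module Family {r} (opt : Optimum r) (k : ℕ) where
    open Optimum opt

    n a₀ v₀ c₀ : ℕ
    n  = r ℕ.+ k ℕ.* 11
    a₀ = α ℕ.+ 4 ℕ.* k
    v₀ = β ℕ.+ 2 ℕ.* k
    c₀ = γ ℕ.+ k

    -- Twice the value at the candidate, as an integer.
    F : ℤ
    F = Λ (+ a₀) (+ v₀) (+ c₀)

    n-split : n ≡ a₀ ℕ.+ (a₀ ℕ.+ v₀) ℕ.+ c₀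
    n-split = trans (cong (ℕ._+ k ℕ.* 11) r-split) (spread α β γ k)
      where
      spread : ∀ α β γ k → α ℕ.+ (α ℕ.+ β) ℕ.+ γ ℕ.+ k ℕ.* 11
                         ≡ α ℕ.+ 4 ℕ.* k ℕ.+ (α ℕ.+ 4 ℕ.* k ℕ.+ (β ℕ.+ 2 ℕ.* k)) ℕ.+ (γ ℕ.+ k)
      spread = NatSolver.solve-∀

    s₀-value : (4 ℕ.* n ℕ.+ 2) / 11 ≡ a₀
    s₀-value = trans (cong (_/ 11) (regroup r k))
                 (trans (shift-/11 (4 ℕ.* r ℕ.+ 2) (4 ℕ.* k)) (cong (ℕ._+ 4 ℕ.* k) s₀-base))
      where
      regroup : ∀ r k → 4 ℕ.* (r ℕ.+ k ℕ.* 11) ℕ.+ 2 ≡ 4 ℕ.* r ℕ.+ 2 ℕ.+ 4 ℕ.* k ℕ.* 11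
      regroup = NatSolver.solve-∀

    t₀-value : (10 ℕ.* n) / 11 ≡ a₀ ℕ.+ (a₀ ℕ.+ v₀)
    t₀-value = trans (cong (_/ 11) (regroup r k))
                 (trans (shift-/11 (10 ℕ.* r) (10 ℕ.* k)) (trans (cong (ℕ._+ 10 ℕ.* k) t₀-base) (spread α β k)))
      where
      regroup : ∀ r k → 10 ℕ.* (r ℕ.+ k ℕ.* 11) ≡ 10 ℕ.* r ℕ.+ 10 ℕ.* k ℕ.* 11
      regroup = NatSolver.solve-∀
      spread : ∀ α β k → α ℕ.+ (α ℕ.+ β) ℕ.+ 10 ℕ.* k
                       ≡ α ℕ.+ 4 ℕ.* k ℕ.+ (α ℕ.+ 4 ℕ.* k ℕ.+ (β ℕ.+ 2 ℕ.* k))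
      spread = NatSolver.solve-∀

    value : M n a₀ (a₀ ℕ.+ (a₀ ℕ.+ v₀)) ≡ tri a₀ ℕ.+ tri v₀ ℕ.+ 2 ℕ.* tri c₀
    value = trans (cong (λ N → M N a₀ (a₀ ℕ.+ (a₀ ℕ.+ v₀))) n-split)
                  (M-short-top a₀ v₀ c₀ (ℕ.+-mono-≤ top-short (ℕ.m≤n*m k 4)))

    value-cast : + (2 ℕ.* (tri a₀ ℕ.+ tri v₀ ℕ.+ 2 ℕ.* tri c₀)) ≡ F
    value-cast = begin
      + (2 ℕ.* (tri a₀ ℕ.+ tri v₀ ℕ.+ 2 ℕ.* tri c₀))
        ≡⟨ cong +_ (distribute (tri a₀) (tri v₀) (tri c₀)) ⟩
      + (2 ℕ.* tri a₀ ℕ.+ 2 ℕ.* tri v₀ ℕ.+ 2 ℕ.* (2 ℕ.* tri c₀))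
        ≡⟨ pos-+ (2 ℕ.* tri a₀ ℕ.+ 2 ℕ.* tri v₀) (2 ℕ.* (2 ℕ.* tri c₀)) ⟩
      + (2 ℕ.* tri a₀ ℕ.+ 2 ℕ.* tri v₀) + + (2 ℕ.* (2 ℕ.* tri c₀))
        ≡⟨ cong₂ _+_ (trans (pos-+ (2 ℕ.* tri a₀) (2 ℕ.* tri v₀)) (cong₂ _+_ (tri-cast a₀) (tri-cast v₀)))
                     (trans (pos-* 2 (2 ℕ.* tri c₀)) (cong (+ 2 *_) (tri-cast c₀))) ⟩
      F ∎
      where
      open ≡-Reasoning
      distribute : ∀ x y z → 2 ℕ.* (x ℕ.+ y ℕ.+ 2 ℕ.* z) ≡ 2 ℕ.* x ℕ.+ 2 ℕ.* y ℕ.+ 2 ℕ.* (2 ℕ.* z)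
      distribute = NatSolver.solve-∀

    cast-a₀ : + a₀ ≡ + α + + 4 * + k
    cast-a₀ = trans (pos-+ α (4 ℕ.* k)) (cong (λ x → + α + x) (pos-* 4 k))
    cast-v₀ : + v₀ ≡ + β + + 2 * + k
    cast-v₀ = trans (pos-+ β (2 ℕ.* k)) (cong (λ x → + β + x) (pos-* 2 k))
    cast-c₀ : + c₀ ≡ + γ + + k
    cast-c₀ = pos-+ γ k

    slope-p : + 2 * + a₀ - + 4 * + v₀ + + 1 ≡ + 2 * + α - + 4 * + β + + 1
    slope-p = trans (cong₂ (λ A V → + 2 * A - + 4 * V + + 1) cast-a₀ cast-v₀) (drop-k (+ α) (+ β) (+ k))
      where
      drop-k : ∀ α β k → + 2 * (α + + 4 * k) - + 4 * (β + + 2 * k) + + 1 ≡ + 2 * α - + 4 * β + + 1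
      drop-k = solve-∀

    slope-q : + 4 * + c₀ - + 2 * + v₀ - + 1 ≡ + 4 * + γ - + 2 * + β - + 1
    slope-q = trans (cong₂ (λ C V → + 4 * C - + 2 * V - + 1) cast-c₀ cast-v₀) (drop-k (+ γ) (+ β) (+ k))
      where
      drop-k : ∀ γ β k → + 4 * (γ + k) - + 2 * (β + + 2 * k) - + 1 ≡ + 4 * γ - + 2 * β - + 1
      drop-k = solve-∀

    below-model : ∀ a b c → a + b + c ≡ + n → F ≤ℤ Λ a (b - a) c
    below-model a b c on-plane =
      model-minimum (+ a₀) (+ v₀) (+ c₀) w
        (subst (λ p → 0ℤ ≤ℤ + 3 + (p - w)) (sym slope-p) u₊) (subst (λ p → 0ℤ ≤ℤ + 3 - (p - w)) (sym slope-p) u₋)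
        (subst (λ q → 0ℤ ≤ℤ + 1 + (q - w)) (sym slope-q) v₊) (subst (λ q → 0ℤ ≤ℤ + 1 - (q - w)) (sym slope-q) v₋)
        w₊ w₋ a b c (trans on-plane (cong +_ n-split))

    below-threshold : + 11 * F ≤ℤ Θ (+ n)
    below-threshold = 0≤i-j⇒j≤i (subst (0ℤ ≤ℤ_) (sym gap) threshold)
      where
      constant-gap : ∀ α β γ k →
        let A = α + + 4 * k ; V = β + + 2 * k ; C = γ + k ; N = A + (A + V) + C ; r = α + (α + β) + γ in
        (+ 2 * (N * N) - + 8 * N + + 12) - + 11 * (A * (A - + 1) + V * (V - + 1) + + 2 * (C * (C - + 1)))
        ≡ (+ 2 * (r * r) - + 8 * r + + 12) - + 11 * (α * (α - + 1) + β * (β - + 1) + + 2 * (γ * (γ - + 1)))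
      constant-gap = solve-∀
      gap : Θ (+ n) - + 11 * F ≡ Θ (+ r) - + 11 * Λ (+ α) (+ β) (+ γ)
      gap = begin
        Θ (+ n) - + 11 * F
          ≡⟨ cong (λ N → Θ N - + 11 * F) (cong +_ n-split) ⟩
        Θ (+ a₀ + (+ a₀ + + v₀) + + c₀) - + 11 * Λ (+ a₀) (+ v₀) (+ c₀)
          ≡⟨ cong-gap cast-a₀ cast-v₀ cast-c₀ ⟩
        Θ (A + (A + V) + C) - + 11 * Λ A V C
          ≡⟨ constant-gap (+ α) (+ β) (+ γ) (+ k) ⟩
        Θ (+ α + (+ α + + β) + + γ) - + 11 * Λ (+ α) (+ β) (+ γ)
          ≡⟨ cong (λ R → Θ R - + 11 * Λ (+ α) (+ β) (+ γ)) (cong +_ (sym r-split)) ⟩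
        Θ (+ r) - + 11 * Λ (+ α) (+ β) (+ γ) ∎
        where
        open ≡-Reasoning
        A = + α + + 4 * + k
        V = + β + + 2 * + k
        C = + γ + + k
        cong-gap : ∀ {A A′ V V′ C C′} → A ≡ A′ → V ≡ V′ → C ≡ C′ →
          Θ (A + (A + V) + C) - + 11 * Λ A V C ≡ Θ (A′ + (A′ + V′) + C′) - + 11 * Λ A′ V′ C′
        cong-gap refl refl refl = refl

    minimal : 5 ≤ n → ∀ s t → s ≤ t → t ≤ n → M n ((4 ℕ.* n ℕ.+ 2) / 11) ((10 ℕ.* n) / 11) ≤ M n s t
    minimal n≥5 s t s≤t t≤n =
      subst₂ (λ S T → M n S T ≤ M n s t) (sym s₀-value) (sym t₀-value)
        (ℕ.≤-trans (ℕ.≤-reflexive value) (ℕ.*-cancelˡ-≤ 2 (drop‿+≤+ twice)))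
      where
      twice : + (2 ℕ.* (tri a₀ ℕ.+ tri v₀ ℕ.+ 2 ℕ.* tri c₀)) ≤ℤ + (2 ℕ.* M n s t)
      twice = subst (_≤ℤ + (2 ℕ.* M n s t)) (sym value-cast)
                (lower-bound n F n≥5 below-model below-threshold s t s≤t t≤n)

  optimum-table : ∀ r → r < 11 → Optimum r
  optimum-table 0  _ = optimum 0 0 0 (+ 0)       refl refl refl z≤n       ✓ ✓ ✓ ✓ ✓ ✓ ✓
  optimum-table 1  _ = optimum 0 0 1 (+ 2)       refl refl refl (s≤s z≤n) ✓ ✓ ✓ ✓ ✓ ✓ ✓
  optimum-table 2  _ = optimum 0 1 1 (+ 0)       refl refl refl (s≤s z≤n) ✓ ✓ ✓ ✓ ✓ ✓ ✓
  optimum-table 3  _ = optimum 1 0 1 (+ 2)       refl refl refl (s≤s z≤n) ✓ ✓ ✓ ✓ ✓ ✓ ✓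
  optimum-table 4  _ = optimum 1 1 1 (+ 0)       refl refl refl (s≤s z≤n) ✓ ✓ ✓ ✓ ✓ ✓ ✓
  optimum-table 5  _ = optimum 2 0 1 (+ 2)       refl refl refl (s≤s z≤n) ✓ ✓ ✓ ✓ ✓ ✓ ✓
  optimum-table 6  _ = optimum 2 1 1 (+ 0)       refl refl refl (s≤s z≤n) ✓ ✓ ✓ ✓ ✓ ✓ ✓
  optimum-table 7  _ = optimum 2 2 1 (+ 0)       refl refl refl (s≤s z≤n) ✓ ✓ ✓ ✓ ✓ ✓ ✓
  optimum-table 8  _ = optimum 3 1 1 (+ 0)       refl refl refl (s≤s z≤n) ✓ ✓ ✓ ✓ ✓ ✓ ✓
  optimum-table 9  _ = optimum 3 2 1 (+ 0)       refl refl refl (s≤s z≤n) ✓ ✓ ✓ ✓ ✓ ✓ ✓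
  optimum-table 10 _ = optimum 3 3 1 (-[1+ 1 ])  refl refl refl (s≤s z≤n) ✓ ✓ ✓ ✓ ✓ ✓ ✓
  optimum-table (suc (suc (suc (suc (suc (suc (suc (suc (suc (suc (suc _)))))))))))
    (s≤s (s≤s (s≤s (s≤s (s≤s (s≤s (s≤s (s≤s (s≤s (s≤s (s≤s ())))))))))))

  no-triples : ∀ n → n < 5 → M n ((4 ℕ.* n ℕ.+ 2) / 11) ((10 ℕ.* n) / 11) ≡ 0
  no-triples 0 _ = refl
  no-triples 1 _ = refl
  no-triples 2 _ = refl
  no-triples 3 _ = refl
  no-triples 4 _ = refl
  no-triples (suc (suc (suc (suc (suc _))))) (s≤s (s≤s (s≤s (s≤s (s≤s ())))))


open import Data.Nat using (ℕ; _+_; _*_; _≤_; _/_; _%_; _≤?_; z≤n)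
open import Data.Nat.Properties using (≰⇒>)
open import Data.Nat.DivMod using (m≡m%n+[m/n]*n; m%n<n)
open import Relation.Binary.PropositionalEquality using (_≡_; subst; sym)
open import Relation.Nullary using (yes; no)
open Minimiser

lemma2 : (n s t : ℕ) → s ≤ t → t ≤ n →
    M n ((4 * n + 2) / 11) ((10 * n) / 11) ≤ M n s t
lemma2 n s t s≤t t≤n with 5 ≤? n
... | no  n≱5 = subst (_≤ M n s t) (sym (no-triples n (≰⇒> n≱5))) z≤n
... | yes n≥5 =
  subst (λ N → M N ((4 * N + 2) / 11) ((10 * N) / 11) ≤ M N s t) (sym n≡r+11k)
    (Family.minimal (optimum-table (n % 11) (m%n<n n 11)) (n / 11)
       (subst (5 ≤_) n≡r+11k n≥5) s t s≤t (subst (t ≤_) n≡r+11k t≤n))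
  where
  n≡r+11k : n ≡ n % 11 + (n / 11) * 11
  n≡r+11k = m≡m%n+[m/n]*n n 11
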